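{- Let $n\geq 2$ be an odd integer and $d\geq 1$ an integer. Let $\{B^1,B^2,\ldots,B^m\}$ be a partition of $[n]^d$ into proper, odd bricks. Then $m\geq 3^d$.
   Context: $[n]=\{1,\dots,n\}$. A sub-box of $[n]^d$ is a set $B=B_1\times\cdots\times B_d$ with $B_i\subseteq[n]$; it is proper if $B_i\neq[n]$ for every $i$, and odd if every $|B_i|$ is odd. A brick is a sub-box in which every $B_i$ is an interval of integers $\{a,a+1,\dots,b\}$ with $a\le b$. A partition means the bricks are pairwise disjoint with union $[n]^d$. -}

module Defs where

open import Data.Nat using (ℕ; suc; _+_; _∸_; _≤_; _^_)
open import Data.Fin using (Fin)
open import Data.Product using (_×_; ∃-syntax)
open import Relation.Nullary using (¬_)
open import Relation.Binary.PropositionalEquality using (_≡_)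

-- A brick in [n]^d : B = B_1 × ... × B_d, with B_i = {lo i, ..., hi i}.
record Brick (d : ℕ) : Set where
  constructor brick
  field
    lo : Fin d → ℕ
    hi : Fin d → ℕ
open Brick public

Odd : ℕ → Set
Odd k = ∃[ t ] (k ≡ suc (t + t))

-- A point of [n]^d (as an element of ℕ^d; membership in [n]^d is InCube).
Point : ℕ → Set
Point d = Fin d → ℕ

InCube : ∀ {d} → ℕ → Point d → Set
InCube n x = ∀ i → (1 ≤ x i) × (x i ≤ n)

IsBrickIn : ∀ {d} → ℕ → Brick d → Set
IsBrickIn n B = ∀ i → (1 ≤ lo B i) × (lo B i ≤ hi B i) × (hi B i ≤ n)

_∈B_ : ∀ {d} → Point d → Brick d → Set
x ∈B B = ∀ i → (lo B i ≤ x i) × (x i ≤ hi B i)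

Proper : ∀ {d} → ℕ → Brick d → Set
Proper n B = ∀ i → ¬ ((lo B i ≡ 1) × (hi B i ≡ n))

OddBrick : ∀ {d} → Brick d → Set
OddBrick B = ∀ i → Odd (suc (hi B i ∸ lo B i))

IsPartition : ∀ {d m} → ℕ → (Fin m → Brick d) → Set
IsPartition {d} {m} n B =
  (∀ j → IsBrickIn n (B j)) ×
  (∀ j k → ¬ (j ≡ k) → ∀ (x : Point d) → ¬ ((x ∈B B j) × (x ∈B B k))) ×
  (∀ (x : Point d) → InCube n x → ∃[ j ] (x ∈B B j))

module Submission where

-- The proof is a parity argument.  Call a list of bricks an odd cover of
-- [n]^d if every point of the cube lies in an odd number of them; a partition
-- is in particular an odd cover.  We show by induction on d that an odd cover
-- by admissible bricks (odd sides, no side equal to [1, n]) has at least 3^d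
-- members.  Split the bricks of [n]^(d+1) according to their first side: it
-- contains 1 (bottom layer), contains n (top layer), or neither (middle
-- layer); properness makes these classes disjoint.  Deleting the first side,
--   * the bottom and top layers are the slices of the cover at heights 1 and
--     n, hence odd covers of [n]^d;
--   * summing parities over a whole column t = 1, …, n gives n, which is odd,
--     while every brick meets the column in an odd number of points, so the
--     three layers together form an odd cover; hence so does the middle one.
-- Each layer thus has at least 3^d bricks.

open import Defs
open import Data.Nat using (ℕ; zero; suc; _+_; _∸_; _≤_; _^_; _⊓_; _≤ᵇ_; _≤?_; z≤n; s≤s)
open import Data.Nat.Properties
  using ( ≤-refl; ≤-reflexive; ≤-trans; ≤-antisym; ≤-pred; <⇒≤; ≤⇒≯; ≰⇒>; m≤n⇒m≤1+n; ≤ᵇ⇒≤; ≤⇒≤ᵇ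
        ; +-suc; +-identityʳ; +-mono-≤; +-∸-assoc; m∸n+n≡m; m≤n⇒m⊓n≡m; m≥n⇒m⊓n≡n)
open import Data.Bool using (Bool; true; false; not; _∧_; _∨_; _xor_; T)
open import Data.Bool.Properties
  using (xor-same; xor-assoc; xor-identityʳ; not-distribˡ-xor; not-involutive; ∧-distribʳ-xor; T-∧; T-≡; xor-∧-commutativeRing)
open import Data.Unit using (tt)
open import Data.Empty using (⊥-elim)
open import Data.Fin using (Fin; zero; suc)
open import Data.Fin.Properties using (suc-injective)
open import Data.Vec.Functional using (tail) renaming (_∷_ to _◂_)
open import Data.List using (List; []; _∷_; length; map; filterᵇ; tabulate; applyDownFrom)
open import Data.List.Properties using (length-map; length-tabulate)
open import Data.List.Membership.Propositional using (_∈_)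
open import Data.List.Membership.Propositional.Properties using (∈-applyDownFrom⁻)
open import Data.List.Relation.Unary.All as All using (All)
open import Data.List.Relation.Unary.All.Properties using (map⁺; filter⁺; tabulate⁺)
open import Data.List.Relation.Unary.Any using (here; there)
open import Data.Product using (_×_; _,_; proj₁; proj₂)
open import Function using (_∘_)
open import Function.Bundles using (Equivalence)
open import Relation.Nullary using (¬_; yes; no)
open import Relation.Nullary.Decidable using (T?; dec-true; dec-false)
open import Relation.Binary.PropositionalEquality
open import Algebra.Bundles using (CommutativeRing)
open import Algebra.Properties.CommutativeSemigroup
  (CommutativeRing.+-commutativeSemigroup xor-∧-commutativeRing) using (interchange)

open Equivalence using (to; from)
open ≡-Reasoning

¬T⇒false : ∀ {b} → ¬ T b → b ≡ false
¬T⇒false {false} _  = refl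
¬T⇒false {true}  ¬b = ⊥-elim (¬b tt)

≤ᵇ-true : ∀ {m n} → m ≤ n → (m ≤ᵇ n) ≡ true
≤ᵇ-true {m} {n} = dec-true (m ≤? n)

≤ᵇ-false : ∀ {m n} → ¬ m ≤ n → (m ≤ᵇ n) ≡ false
≤ᵇ-false {m} {n} = dec-false (m ≤? n)

isOdd : ℕ → Bool
isOdd zero    = false
isOdd (suc k) = not (isOdd k)

isOdd-+ : ∀ a b → isOdd (a + b) ≡ isOdd a xor isOdd b
isOdd-+ zero    b = refl
isOdd-+ (suc a) b = trans (cong not (isOdd-+ a b)) (not-distribˡ-xor (isOdd a) (isOdd b))

Odd⇒isOdd : ∀ {k} → Odd k → isOdd k ≡ true
Odd⇒isOdd (t , refl) = cong not (trans (isOdd-+ t t) (xor-same (isOdd t)))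

Odd⇒positive : ∀ {k} → Odd k → 1 ≤ k
Odd⇒positive (t , refl) = s≤s z≤n

parity : {A : Set} → (A → Bool) → List A → Bool
parity f []       = false
parity f (x ∷ xs) = f x xor parity f xs

module _ {A : Set} where

  parity-false : (xs : List A) → parity (λ _ → false) xs ≡ false
  parity-false []       = refl
  parity-false (x ∷ xs) = parity-false xs

  parity-cong : ∀ {f g : A → Bool} (xs : List A) →
    (∀ {x} → x ∈ xs → f x ≡ g x) → parity f xs ≡ parity g xs
  parity-cong []       f≡g = refl
  parity-cong (x ∷ xs) f≡g = cong₂ _xor_ (f≡g (here refl)) (parity-cong xs (f≡g ∘ there))

  parity-xor : ∀ (f g : A → Bool) xs →
    parity (λ x → f x xor g x) xs ≡ parity f xs xor parity g xs
  parity-xor f g []       = refl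
  parity-xor f g (x ∷ xs) = begin
    (f x xor g x) xor parity (λ y → f y xor g y) xs
      ≡⟨ cong ((f x xor g x) xor_) (parity-xor f g xs) ⟩
    (f x xor g x) xor (parity f xs xor parity g xs)
      ≡⟨ interchange (f x) (g x) (parity f xs) (parity g xs) ⟩
    (f x xor parity f xs) xor (g x xor parity g xs) ∎

  parity-∧ʳ : ∀ (f : A → Bool) c xs → parity (λ x → f x ∧ c) xs ≡ parity f xs ∧ c
  parity-∧ʳ f c []       = refl
  parity-∧ʳ f c (x ∷ xs) = begin
    (f x ∧ c) xor parity (λ y → f y ∧ c) xs ≡⟨ cong ((f x ∧ c) xor_) (parity-∧ʳ f c xs) ⟩
    (f x ∧ c) xor (parity f xs ∧ c)         ≡⟨ ∧-distribʳ-xor c (f x) (parity f xs) ⟨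
    (f x xor parity f xs) ∧ c               ∎

  parity-filter : ∀ (f p : A → Bool) xs →
    parity f (filterᵇ p xs) ≡ parity (λ x → p x ∧ f x) xs
  parity-filter f p []       = refl
  parity-filter f p (x ∷ xs) with p x
  ... | true  = cong (f x xor_) (parity-filter f p xs)
  ... | false = parity-filter f p xs

  parity-map : ∀ {B : Set} (f : B → Bool) (g : A → B) xs →
    parity f (map g xs) ≡ parity (f ∘ g) xs
  parity-map f g []       = refl
  parity-map f g (x ∷ xs) = cong (f (g x) xor_) (parity-map f g xs)

  parity-swap : ∀ {B : Set} (g : B → A → Bool) (ys : List B) (xs : List A) →
    parity (λ y → parity (g y) xs) ys ≡ parity (λ x → parity (λ y → g y x) ys) xs
  parity-swap g []       xs = sym (parity-false xs)
  parity-swap g (y ∷ ys) xs = begin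
    parity (g y) xs xor parity (λ y′ → parity (g y′) xs) ys
      ≡⟨ cong (parity (g y) xs xor_) (parity-swap g ys xs) ⟩
    parity (g y) xs xor parity (λ x → parity (λ y′ → g y′ x) ys) xs
      ≡⟨ parity-xor (g y) (λ x → parity (λ y′ → g y′ x) ys) xs ⟨
    parity (λ x → g y x xor parity (λ y′ → g y′ x) ys) xs ∎

  parity-none : ∀ {m} (f : A → Bool) (g : Fin m → A) →
    (∀ k → f (g k) ≡ false) → parity f (tabulate g) ≡ false
  parity-none {zero}  f g none = refl
  parity-none {suc m} f g none =
    cong₂ _xor_ (none zero) (parity-none f (g ∘ suc) (none ∘ suc))

  parity-unique : ∀ {m} (f : A → Bool) (g : Fin m → A) (j : Fin m) →
    f (g j) ≡ true → (∀ k → j ≢ k → f (g k) ≡ false) → parity f (tabulate g) ≡ true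
  parity-unique f g zero    fj others =
    cong₂ _xor_ fj (parity-none f (g ∘ suc) (λ k → others (suc k) λ ()))
  parity-unique f g (suc j) fj others =
    cong₂ _xor_ (others zero λ ())
      (parity-unique f (g ∘ suc) j fj (λ k j≢k → others (suc k) (j≢k ∘ suc-injective)))

-- range n lists the heights n, n-1, …, 1 of a column of [n]^(d+1).
range : ℕ → List ℕ
range = applyDownFrom suc

∈-range : ∀ {n t} → t ∈ range n → (1 ≤ t) × (t ≤ n)
∈-range t∈ with ∈-applyDownFrom⁻ suc t∈
... | i , i<n , refl = s≤s z≤n , i<n

range-parity : ∀ n → parity (λ _ → true) (range n) ≡ isOdd n
range-parity zero    = refl
range-parity (suc n) = cong not (range-parity n)

between : ℕ → ℕ → ℕ → Bool
between a b t = (a ≤ᵇ t) ∧ (t ≤ᵇ b)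

between-sound : ∀ {a b t} → T (between a b t) → (a ≤ t) × (t ≤ b)
between-sound {a} {b} {t} t∈ with to T-∧ t∈
... | a≤t , t≤b = ≤ᵇ⇒≤ a t a≤t , ≤ᵇ⇒≤ t b t≤b

between-complete : ∀ {a b t} → (a ≤ t) × (t ≤ b) → T (between a b t)
between-complete (a≤t , t≤b) = from T-∧ (≤⇒≤ᵇ a≤t , ≤⇒≤ᵇ t≤b)

between-as-xor : ∀ {l h} t → l ≤ h → between (suc l) h t ≡ (t ≤ᵇ h) xor (t ≤ᵇ l)
between-as-xor {l} {h} t l≤h with t ≤? l
... | yes t≤l rewrite ≤ᵇ-false (≤⇒≯ t≤l) | ≤ᵇ-true t≤l | ≤ᵇ-true (≤-trans t≤l l≤h) = refl
... | no  t≰l rewrite ≤ᵇ-true (≰⇒> t≰l) | ≤ᵇ-false t≰l = sym (xor-identityʳ _)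

prefix-parity : ∀ k a → parity (_≤ᵇ a) (range k) ≡ isOdd (k ⊓ a)
prefix-parity zero    a = refl
prefix-parity (suc k) a with suc k ≤? a
... | yes k<a rewrite ≤ᵇ-true k<a = begin
  not (parity (_≤ᵇ a) (range k)) ≡⟨ cong not (prefix-parity k a) ⟩
  not (isOdd (k ⊓ a))            ≡⟨ cong (not ∘ isOdd) (m≤n⇒m⊓n≡m (<⇒≤ k<a)) ⟩
  isOdd (suc k)                  ≡⟨ cong isOdd (m≤n⇒m⊓n≡m k<a) ⟨
  isOdd (suc k ⊓ a)              ∎
... | no  k≮a rewrite ≤ᵇ-false k≮a = begin
  parity (_≤ᵇ a) (range k) ≡⟨ prefix-parity k a ⟩
  isOdd (k ⊓ a)            ≡⟨ cong isOdd (m≥n⇒m⊓n≡n a≤k) ⟩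
  isOdd a                  ≡⟨ cong isOdd (m≥n⇒m⊓n≡n (m≤n⇒m≤1+n a≤k)) ⟨
  isOdd (suc k ⊓ a)        ∎
  where a≤k = ≤-pred (≰⇒> k≮a)

interval-parity : ∀ {n a b} → 1 ≤ a → a ≤ b → b ≤ n →
  parity (between a b) (range n) ≡ isOdd (suc (b ∸ a))
interval-parity {n} {suc l} {b} _ l<b b≤n = begin
  parity (between (suc l) b) (range n)
    ≡⟨ parity-cong (range n) (λ {t} _ → between-as-xor t l≤b) ⟩
  parity (λ t → (t ≤ᵇ b) xor (t ≤ᵇ l)) (range n)
    ≡⟨ parity-xor (_≤ᵇ b) (_≤ᵇ l) (range n) ⟩
  parity (_≤ᵇ b) (range n) xor parity (_≤ᵇ l) (range n)
    ≡⟨ cong₂ _xor_ (prefix-parity n b) (prefix-parity n l) ⟩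
  isOdd (n ⊓ b) xor isOdd (n ⊓ l)
    ≡⟨ cong₂ (λ u v → isOdd u xor isOdd v) (m≥n⇒m⊓n≡n b≤n) (m≥n⇒m⊓n≡n (≤-trans l≤b b≤n)) ⟩
  isOdd b xor isOdd l
    ≡⟨ cong (λ u → isOdd u xor isOdd l) (m∸n+n≡m l≤b) ⟨
  isOdd (b ∸ l + l) xor isOdd l
    ≡⟨ cong (_xor isOdd l) (isOdd-+ (b ∸ l) l) ⟩
  (isOdd (b ∸ l) xor isOdd l) xor isOdd l
    ≡⟨ xor-assoc (isOdd (b ∸ l)) (isOdd l) (isOdd l) ⟩
  isOdd (b ∸ l) xor (isOdd l xor isOdd l)
    ≡⟨ cong (isOdd (b ∸ l) xor_) (xor-same (isOdd l)) ⟩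
  isOdd (b ∸ l) xor false
    ≡⟨ xor-identityʳ (isOdd (b ∸ l)) ⟩
  isOdd (b ∸ l)
    ≡⟨ cong isOdd (+-∸-assoc 1 l<b) ⟩
  isOdd (suc (b ∸ suc l)) ∎
  where l≤b = <⇒≤ l<b

AdmissibleSide : ℕ → ℕ → ℕ → Set
AdmissibleSide n a b = ((1 ≤ a) × (a ≤ b) × (b ≤ n)) × ¬ ((a ≡ 1) × (b ≡ n)) × Odd (suc (b ∸ a))

Admissible : ∀ {d} → ℕ → Brick d → Set
Admissible n B = ∀ i → AdmissibleSide n (lo B i) (hi B i)

side-misses-an-end : ∀ {n a b} → AdmissibleSide n a b → between a b 1 ∧ between a b n ≡ false
side-misses-an-end {n} {a} {b} ((1≤a , _ , b≤n) , proper , _) = ¬T⇒false λ both →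
  let a≤1 , _ = between-sound {a} {b} {1} (proj₁ (to T-∧ both))
      _ , n≤b = between-sound {a} {b} {n} (proj₂ (to (T-∧ {between a b 1}) both))
  in proper (≤-antisym a≤1 1≤a , ≤-antisym b≤n n≤b)

side-column-parity : ∀ {n a b} → AdmissibleSide n a b → parity (between a b) (range n) ≡ true
side-column-parity ((1≤a , a≤b , b≤n) , _ , odd) =
  trans (interval-parity 1≤a a≤b b≤n) (Odd⇒isOdd odd)

-- A brick (point) of [n]^(d+1) is a first side (coordinate) followed by a
-- brick (point) of [n]^d.
-- meets t B: the first side of B contains t, i.e. B meets the hyperplane x₀ = t.
meets : ∀ {d} → ℕ → Brick (suc d) → Bool
meets t B = between (lo B zero) (hi B zero) t

rest : ∀ {d} → Brick (suc d) → Brick d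
rest B = brick (tail (lo B)) (tail (hi B))

rest-admissible : ∀ {n d} {B : Brick (suc d)} → Admissible n B → Admissible n (rest B)
rest-admissible adm = adm ∘ suc

_∈ᵇ_ : ∀ {d} → Point d → Brick d → Bool
_∈ᵇ_ {zero}  x B = true
_∈ᵇ_ {suc d} x B = meets (x zero) B ∧ (tail x ∈ᵇ rest B)

∈ᵇ-sound : ∀ {d} {x : Point d} (B : Brick d) → T (x ∈ᵇ B) → x ∈B B
∈ᵇ-sound {zero}  B x∈ ()
∈ᵇ-sound {suc d} B x∈ zero    = between-sound (proj₁ (to T-∧ x∈))
∈ᵇ-sound {suc d} B x∈ (suc i) = ∈ᵇ-sound (rest B) (proj₂ (to T-∧ x∈)) i

∈ᵇ-complete : ∀ {d} {x : Point d} (B : Brick d) → x ∈B B → T (x ∈ᵇ B)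
∈ᵇ-complete {zero}  B x∈ = tt
∈ᵇ-complete {suc d} B x∈ = from T-∧ (between-complete (x∈ zero) , ∈ᵇ-complete (rest B) (x∈ ∘ suc))

cube-∷ : ∀ {n d t} {y : Point d} → (1 ≤ t) × (t ≤ n) → InCube n y → InCube n (t ◂ y)
cube-∷ t∈ y∈ zero    = t∈
cube-∷ t∈ y∈ (suc i) = y∈ i

module _ {A : Set} (p q : A → Bool) where

  neither : A → Bool
  neither x = not (p x ∨ q x)

  three-way : ∀ x c → p x ∧ q x ≡ false →
    c ≡ (p x ∧ c) xor ((q x ∧ c) xor (neither x ∧ c))
  three-way x c disjoint with p x | q x | disjoint
  ... | true  | false | _ = sym (xor-identityʳ c)
  ... | false | true  | _ = sym (xor-identityʳ c)
  ... | false | false | _ = refl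

  split-length : ∀ xs → (∀ {x} → x ∈ xs → p x ∧ q x ≡ false) →
    length xs ≡ length (filterᵇ p xs) + (length (filterᵇ q xs) + length (filterᵇ neither xs))
  split-length []       _        = refl
  split-length (x ∷ xs) disjoint with p x | q x | disjoint (here refl)
  ... | true  | false | _ = cong suc (split-length xs (disjoint ∘ there))
  ... | false | true  | _ =
    trans (cong suc (split-length xs (disjoint ∘ there))) (sym (+-suc _ _))
  ... | false | false | _ =
    trans (cong suc (split-length xs (disjoint ∘ there)))
          (sym (trans (cong (length (filterᵇ p xs) +_) (+-suc _ _)) (+-suc _ _)))

  split-parity : ∀ (f : A → Bool) xs → (∀ {x} → x ∈ xs → p x ∧ q x ≡ false) →
    parity f xs ≡ parity f (filterᵇ p xs) xor (parity f (filterᵇ q xs) xor parity f (filterᵇ neither xs))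
  split-parity f xs disjoint = begin
    parity f xs
      ≡⟨ parity-cong xs (λ {x} x∈ → three-way x (f x) (disjoint x∈)) ⟩
    parity (λ x → (p x ∧ f x) xor ((q x ∧ f x) xor (neither x ∧ f x))) xs
      ≡⟨ parity-xor (λ x → p x ∧ f x) _ xs ⟩
    parity (λ x → p x ∧ f x) xs xor parity (λ x → (q x ∧ f x) xor (neither x ∧ f x)) xs
      ≡⟨ cong (parity (λ x → p x ∧ f x) xs xor_) (parity-xor (λ x → q x ∧ f x) _ xs) ⟩
    parity (λ x → p x ∧ f x) xs xor (parity (λ x → q x ∧ f x) xs xor parity (λ x → neither x ∧ f x) xs)
      ≡⟨ cong₂ _xor_ (parity-filter f p xs)
           (cong₂ _xor_ (parity-filter f q xs) (parity-filter f neither xs)) ⟨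
    parity f (filterᵇ p xs) xor (parity f (filterᵇ q xs) xor parity f (filterᵇ neither xs)) ∎

OddCover : ∀ {d} → ℕ → List (Brick d) → Set
OddCover {d} n L = ∀ (y : Point d) → InCube n y → parity (y ∈ᵇ_) L ≡ true

layer : ∀ {d} → (Brick (suc d) → Bool) → List (Brick (suc d)) → List (Brick d)
layer p L = map rest (filterᵇ p L)

slice : ∀ {d} → ℕ → List (Brick (suc d)) → List (Brick d)
slice t = layer (meets t)

middle : ∀ {d} → ℕ → List (Brick (suc d)) → List (Brick d)
middle n = layer (neither (meets 1) (meets n))

layer-admissible : ∀ {n d} (p : Brick (suc d) → Bool) {L} →
  All (Admissible n) L → All (Admissible n) (layer p L)
layer-admissible p adm = map⁺ (All.map rest-admissible (filter⁺ (T? ∘ p) adm))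

ends-disjoint : ∀ {n d} {L : List (Brick (suc d))} → All (Admissible n) L →
  ∀ {B} → B ∈ L → meets 1 B ∧ meets n B ≡ false
ends-disjoint adm B∈ = side-misses-an-end (All.lookup adm B∈ zero)

layers-length : ∀ {n d} {L : List (Brick (suc d))} → All (Admissible n) L →
  length L ≡ length (slice 1 L) + (length (slice n L) + length (middle n L))
layers-length {n} {L = L} adm = begin
  length L
    ≡⟨ split-length (meets 1) (meets n) L (ends-disjoint adm) ⟩
  length (filterᵇ (meets 1) L) + (length (filterᵇ (meets n) L) + length (filterᵇ (neither (meets 1) (meets n)) L))
    ≡⟨ cong₂ _+_ (length-map rest (filterᵇ (meets 1) L))
         (cong₂ _+_ (length-map rest (filterᵇ (meets n) L)) (length-map rest (filterᵇ (neither (meets 1) (meets n)) L))) ⟨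
  length (slice 1 L) + (length (slice n L) + length (middle n L)) ∎

slice-parity : ∀ {d} t (y : Point d) L → parity (y ∈ᵇ_) (slice t L) ≡ parity ((t ◂ y) ∈ᵇ_) L
slice-parity t y L =
  trans (parity-map (y ∈ᵇ_) rest (filterᵇ (meets t) L)) (parity-filter (λ B → y ∈ᵇ rest B) (meets t) L)

slice-cover : ∀ {n d t} {L : List (Brick (suc d))} → (1 ≤ t) × (t ≤ n) →
  OddCover n L → OddCover n (slice t L)
slice-cover {t = t} {L} t∈ cover y y∈ = trans (slice-parity t y L) (cover (t ◂ y) (cube-∷ t∈ y∈))

-- Counting along the column through y: every admissible brick meets it an odd
-- number of times, so the column records the projections of the bricks.
column-parity : ∀ {n d} {L : List (Brick (suc d))} → All (Admissible n) L → (y : Point d) →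
  parity (λ t → parity ((t ◂ y) ∈ᵇ_) L) (range n) ≡ parity (λ B → y ∈ᵇ rest B) L
column-parity {n} {L = L} adm y = begin
  parity (λ t → parity (λ B → meets t B ∧ (y ∈ᵇ rest B)) L) (range n)
    ≡⟨ parity-swap (λ t B → meets t B ∧ (y ∈ᵇ rest B)) (range n) L ⟩
  parity (λ B → parity (λ t → meets t B ∧ (y ∈ᵇ rest B)) (range n)) L
    ≡⟨ parity-cong L (λ {B} B∈ → trans (parity-∧ʳ (λ t → meets t B) (y ∈ᵇ rest B) (range n))
                                       (cong (_∧ (y ∈ᵇ rest B)) (side-column-parity (All.lookup adm B∈ zero)))) ⟩
  parity (λ B → y ∈ᵇ rest B) L ∎

layers-parity : ∀ {n d} {L : List (Brick (suc d))} → All (Admissible n) L → (y : Point d) →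
  parity (λ B → y ∈ᵇ rest B) L ≡
  parity (y ∈ᵇ_) (slice 1 L) xor (parity (y ∈ᵇ_) (slice n L) xor parity (y ∈ᵇ_) (middle n L))
layers-parity {n} {L = L} adm y = begin
  parity (λ B → y ∈ᵇ rest B) L
    ≡⟨ split-parity (meets 1) (meets n) (λ B → y ∈ᵇ rest B) L (ends-disjoint adm) ⟩
  parity g (filterᵇ (meets 1) L) xor (parity g (filterᵇ (meets n) L) xor parity g (filterᵇ (neither (meets 1) (meets n)) L))
    ≡⟨ cong₂ _xor_ (parity-map (y ∈ᵇ_) rest (filterᵇ (meets 1) L))
         (cong₂ _xor_ (parity-map (y ∈ᵇ_) rest (filterᵇ (meets n) L))
                      (parity-map (y ∈ᵇ_) rest (filterᵇ (neither (meets 1) (meets n)) L))) ⟨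
  parity (y ∈ᵇ_) (slice 1 L) xor (parity (y ∈ᵇ_) (slice n L) xor parity (y ∈ᵇ_) (middle n L)) ∎
  where g = λ B → y ∈ᵇ rest B

middle-cover : ∀ {n d} {L : List (Brick (suc d))} → Odd n → All (Admissible n) L →
  OddCover n L → OddCover n (middle n L)
middle-cover {n} {L = L} n-odd adm cover y y∈ =
  cancel (slice-cover {L = L} (≤-refl , 1≤n) cover y y∈) (slice-cover {L = L} (1≤n , ≤-refl) cover y y∈) all-layers
  where
  1≤n = Odd⇒positive n-odd

  cancel : ∀ {a b c} → a ≡ true → b ≡ true → a xor (b xor c) ≡ true → c ≡ true
  cancel {c = c} refl refl odd = trans (sym (not-involutive c)) odd

  all-layers : parity (y ∈ᵇ_) (slice 1 L) xor (parity (y ∈ᵇ_) (slice n L) xor parity (y ∈ᵇ_) (middle n L)) ≡ true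
  all-layers = begin
    parity (y ∈ᵇ_) (slice 1 L) xor (parity (y ∈ᵇ_) (slice n L) xor parity (y ∈ᵇ_) (middle n L))
      ≡⟨ layers-parity adm y ⟨
    parity (λ B → y ∈ᵇ rest B) L
      ≡⟨ column-parity adm y ⟨
    parity (λ t → parity ((t ◂ y) ∈ᵇ_) L) (range n)
      ≡⟨ parity-cong (range n) (λ {t} t∈ → cover (t ◂ y) (cube-∷ (∈-range t∈) y∈)) ⟩
    parity (λ _ → true) (range n)
      ≡⟨ range-parity n ⟩
    isOdd n
      ≡⟨ Odd⇒isOdd n-odd ⟩
    true ∎

odd-cover-size : ∀ {n} → Odd n → ∀ d (L : List (Brick d)) →
  All (Admissible n) L → OddCover n L → 3 ^ d ≤ length L
odd-cover-size n-odd zero    []      _   cover with () ← cover (λ ()) (λ ())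
odd-cover-size n-odd zero    (_ ∷ _) _   _     = s≤s z≤n
odd-cover-size {n} n-odd (suc d) L adm cover =
  ≤-trans three-layers (≤-reflexive (sym (layers-length adm)))
  where
  1≤n = Odd⇒positive n-odd

  layer-size : ∀ p → OddCover n (layer p L) → 3 ^ d ≤ length (layer p L)
  layer-size p = odd-cover-size n-odd d (layer p L) (layer-admissible p adm)

  -- 3^(d+1) unfolds to 3^d + (3^d + (3^d + 0)).
  three-layers : 3 ^ suc d ≤ length (slice 1 L) + (length (slice n L) + length (middle n L))
  three-layers =
    +-mono-≤ (layer-size (meets 1) (slice-cover {L = L} (≤-refl , 1≤n) cover))
      (+-mono-≤ (layer-size (meets n) (slice-cover {L = L} (1≤n , ≤-refl) cover))
        (subst (_≤ length (middle n L)) (sym (+-identityʳ (3 ^ d)))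
          (layer-size (neither (meets 1) (meets n)) (middle-cover n-odd adm cover))))

partition-cover : ∀ {n d m} (B : Fin m → Brick d) → IsPartition n B → OddCover n (tabulate B)
partition-cover B (_ , disjoint , covered) y y∈ with covered y y∈
... | j , y∈Bj = parity-unique (y ∈ᵇ_) B j (to T-≡ (∈ᵇ-complete (B j) y∈Bj)) λ k j≢k →
  ¬T⇒false λ y∈Bk → disjoint j k j≢k y (y∈Bj , ∈ᵇ-sound (B k) y∈Bk)

-- Theorem 1.4.  A partition of [n]^d (n odd) into proper odd bricks is an
-- admissible odd cover, so it has at least 3^d parts.
theorem1p4 : (n d m : ℕ) → 2 ≤ n → Odd n → 1 ≤ d →
    (B : Fin m → Brick d) → IsPartition n B →
    (∀ j → Proper n (B j)) → (∀ j → OddBrick (B j)) →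
    3 ^ d ≤ m
theorem1p4 n d m _ n-odd _ B partition proper odd =
  subst (3 ^ d ≤_) (length-tabulate B)
    (odd-cover-size n-odd d (tabulate B) (tabulate⁺ admissible) (partition-cover B partition))
  where
  admissible : ∀ j → Admissible n (B j)
  admissible j i = proj₁ partition j i , proper j i , odd j i
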